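{- Let $\mathbb{U}=(U,\mathcal{B})$ be a unital of order $q>2$, and let $\mathcal{C}\subseteq\mathcal{B}$ be a set of mutually intersecting blocks (i.e., a clique in the confluence graph of $\mathbb{U}$). Then $|\mathcal{C}|\le q^2$, and $|\mathcal{C}|=q^2$ holds if and only if there is a point $x\in U$ such that $\mathcal{C}=\mathcal{B}_x$ is the set of all blocks through $x$.
   Context: A unital of order $q>1$ (with $q$ an integer) is a $2$-$(q^3+1,q+1,1)$ design $\mathbb{U}=(U,\mathcal{B})$: a set $U$ of $q^3+1$ points and a set $\mathcal{B}$ of blocks, each block being a $(q+1)$-subset of $U$, such that any two distinct points lie in exactly one common block. For $x\in U$, $\mathcal{B}_x$ denotes the set of blocks containing $x$ (the pencil of $x$). The confluence graph of $\mathbb{U}$ has vertex set $\mathcal{B}$, two distinct blocks being adjacent if they share a point. -}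

module Defs where

open import Data.Nat using (ℕ; suc; _+_; _^_)
open import Data.Fin using (Fin)
open import Data.Fin.Subset using (Subset; _∈_; ∣_∣)
open import Data.Product using (Σ; ∃; _×_)
open import Relation.Binary.PropositionalEquality using (_≡_; _≢_)
open import Function.Bundles using (_⇔_)

-- A unital of order q: a 2-(q^3+1, q+1, 1) design.
-- Points are Fin (q^3+1); blocks are indexed by Fin b, block i being the
-- point set  block i : Subset (q^3+1).
record Unital (q : ℕ) : Set where
  field
    b          : ℕ
    block      : Fin b → Subset (q ^ 3 + 1)
    block-size : ∀ i → ∣ block i ∣ ≡ q + 1
    joined     : ∀ (x y : Fin (q ^ 3 + 1)) → x ≢ y →
                 ∃ λ i → x ∈ block i × y ∈ block i
    unique     : ∀ (x y : Fin (q ^ 3 + 1)) → x ≢ y → ∀ i j →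
                 x ∈ block i → y ∈ block i →
                 x ∈ block j → y ∈ block j → i ≡ j

module _ {q : ℕ} (U : Unital q) where
  open Unital U

  IsClique : Subset b → Set
  IsClique C = ∀ i j → i ∈ C → j ∈ C → ∃ λ x → x ∈ block i × x ∈ block j

  IsPencil : Subset b → Fin (q ^ 3 + 1) → Set
  IsPencil C x = ∀ i → (i ∈ C ⇔ x ∈ block i)

module Submission where

-- Let d x be the number of clique blocks through the point x and n L = Σ_{x ∈ L} d x the number
-- of clique blocks meeting the block L, counted with multiplicity. Since any two clique blocks meet
-- exactly once, n L = m + q for L ∈ C, where m = |C|, and double counting in the 2-design gives
-- Σ d, Σ d², Σ n and Σ n² as polynomials in q and m. The variance-type sum
-- Σ_{L ∉ C} (n L − (q + 1))² ≥ 0 is then (q² − m) times a positive polynomial, so m ≤ q², and if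
-- m = q² every block outside C meets exactly q + 1 clique blocks.
--
-- For the equality case suppose no point lies on all clique blocks. Then d ≤ q + 1 everywhere, and
-- two points u, w not joined by a clique block satisfy d u + d w ≤ q + 1. If d ≤ q everywhere, the
-- moments force d ∈ {0, q}, and a block of C missing a point w of degree q contains a point of
-- degree q not joined to w inside C. If some w has d w = q + 1, every point of positive degree lies
-- on the q + 1 clique blocks through w, so at most q² + q + 1 points have positive degree; counting
-- around a point of degree j excludes 2 ≤ j ≤ q, and with d ∈ {0, 1, q + 1} the moments say that
-- exactly 2q² points have positive degree.

open import Data.Bool using (true; false)
open import Data.Empty using (⊥; ⊥-elim)
open import Data.Fin using (Fin; zero; suc)
open import Data.Fin.Properties using (any?; all?; ¬∀⟶∃¬) renaming (suc-injective to fsuc-injective)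
open import Data.Fin.Subset using (Subset; ∣_∣; _∈_)
open import Data.Nat
open import Data.Nat.Properties
open import Data.Nat.Tactic.RingSolver using (solve-∀)
open import Data.Product using (∃; _×_; _,_; proj₁; proj₂)
open import Data.Sum using (_⊎_; inj₁; inj₂)
open import Data.Vec using ([]; _∷_; lookup)
open import Data.Vec.Properties using ([]=⇒lookup; lookup⇒[]=)
open import Function using (_∘_)
open import Function.Bundles using (_⇔_; mk⇔; Equivalence)
open import Relation.Binary.PropositionalEquality
  using (_≡_; _≢_; refl; sym; trans; cong; cong₂; subst; subst₂; module ≡-Reasoning)
open import Relation.Nullary using (yes; no; contradiction)
open import Relation.Nullary.Decidable using (_→-dec_)

open import Defs
open import Algebra.Properties.Semiring.Sum +-*-semiring
  using (sum; sum-syntax; ∑-distrib-+; ∑-comm; *-distribˡ-sum; *-distribʳ-sum; sum-cong-≗)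

private
  variable
    k l : ℕ

sum-const : ∀ n c → ∑[ i < n ] c ≡ n * c
sum-const zero    c = refl
sum-const (suc n) c = cong (c +_) (sum-const n c)

sum-mono-≤ : {f g : Fin k → ℕ} → (∀ i → f i ≤ g i) → sum f ≤ sum g
sum-mono-≤ {zero}  f≤g = z≤n
sum-mono-≤ {suc k} f≤g = +-mono-≤ (f≤g zero) (sum-mono-≤ (f≤g ∘ suc))

sum-≤-except : {f g : Fin k → ℕ} (x : Fin k) → (∀ y → y ≢ x → f y ≤ g y) →
               sum f + g x ≤ sum g + f x
sum-≤-except {f = f} {g} zero f≤g = begin
  f zero + sum (f ∘ suc) + g zero  ≤⟨ +-monoˡ-≤ (g zero) (+-monoʳ-≤ (f zero) (sum-mono-≤ λ i → f≤g (suc i) λ ())) ⟩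
  f zero + sum (g ∘ suc) + g zero  ≡⟨ swap (f zero) _ (g zero) ⟩
  g zero + sum (g ∘ suc) + f zero  ∎
  where
  open ≤-Reasoning
  swap : ∀ a b c → a + b + c ≡ c + b + a
  swap = solve-∀
sum-≤-except {f = f} {g} (suc x) f≤g = begin
  f zero + sum (f ∘ suc) + g (suc x)    ≡⟨ +-assoc (f zero) _ _ ⟩
  f zero + (sum (f ∘ suc) + g (suc x))  ≤⟨ +-mono-≤ (f≤g zero λ ()) (sum-≤-except x λ y y≢x → f≤g (suc y) (y≢x ∘ fsuc-injective)) ⟩
  g zero + (sum (g ∘ suc) + f (suc x))  ≡⟨ +-assoc (g zero) _ _ ⟨
  g zero + sum (g ∘ suc) + f (suc x)    ∎
  where open ≤-Reasoning

sum-≡-except : {f g : Fin k → ℕ} (x : Fin k) → (∀ y → y ≢ x → f y ≡ g y) →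
               sum f + g x ≡ sum g + f x
sum-≡-except x f≡g = ≤-antisym (sum-≤-except x (λ y → ≤-reflexive ∘ f≡g y))
                                (sum-≤-except x (λ y → ≤-reflexive ∘ sym ∘ f≡g y))

sum-single : {f : Fin k → ℕ} (x : Fin k) → (∀ y → y ≢ x → f y ≡ 0) → sum f ≡ f x
sum-single {k} {f} x f≡0 = +-cancelʳ-≡ 0 _ _ (begin
  sum f + 0      ≡⟨ sum-≡-except x f≡0 ⟩
  sum {k} (λ _ → 0) + f x ≡⟨ cong (_+ f x) (trans (sum-const k 0) (*-zeroʳ k)) ⟩
  f x            ≡⟨ +-identityʳ (f x) ⟨
  f x + 0        ∎)
  where open ≡-Reasoning

≤-pointwise-sum-≡⇒≡ : {f g : Fin k → ℕ} → (∀ i → f i ≤ g i) → sum f ≡ sum g → ∀ i → f i ≡ g i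
≤-pointwise-sum-≡⇒≡ {f = f} {g} f≤g Σf≡Σg i = ≤-antisym (f≤g i) (+-cancelˡ-≤ (sum g) _ _ (begin
  sum g + g i  ≡⟨ cong (_+ g i) Σf≡Σg ⟨
  sum f + g i  ≤⟨ sum-≤-except i (λ j _ → f≤g j) ⟩
  sum g + f i  ∎))
  where open ≤-Reasoning

term≤sum : (f : Fin k → ℕ) (i : Fin k) → f i ≤ sum f
term≤sum f zero    = m≤m+n (f zero) _
term≤sum f (suc i) = ≤-trans (term≤sum (f ∘ suc) i) (m≤n+m _ (f zero))

two-terms≤sum : (f : Fin k → ℕ) {i j : Fin k} → i ≢ j → f i + f j ≤ sum f
two-terms≤sum f {zero}  {zero}  i≢j = contradiction refl i≢j
two-terms≤sum f {zero}  {suc j} _   = +-monoʳ-≤ (f zero) (term≤sum (f ∘ suc) j)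
two-terms≤sum f {suc i} {zero}  _   = subst (_≤ sum f) (+-comm (f zero) _) (+-monoʳ-≤ (f zero) (term≤sum (f ∘ suc) i))
two-terms≤sum f {suc i} {suc j} i≢j = ≤-trans (two-terms≤sum (f ∘ suc) (i≢j ∘ cong suc)) (m≤n+m _ (f zero))

sum-<⇒∃< : (f g : Fin k → ℕ) → sum f < sum g → ∃ λ i → f i < g i
sum-<⇒∃< {zero}  f g ()
sum-<⇒∃< {suc k} f g Σf<Σg with f zero <? g zero
... | yes f₀<g₀ = zero , f₀<g₀
... | no  f₀≮g₀ =
  let i , fi<gi = sum-<⇒∃< (f ∘ suc) (g ∘ suc)
                    (+-cancelˡ-< (g zero) _ _ (≤-<-trans (+-monoˡ-≤ _ (≮⇒≥ f₀≮g₀)) Σf<Σg))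
  in suc i , fi<gi

0<sum⇒∃0< : (f : Fin k → ℕ) → 0 < sum f → ∃ λ i → 0 < f i
0<sum⇒∃0< {k} f 0<∑f = sum-<⇒∃< (λ _ → 0) f (subst (_< sum f) (sym (trans (sum-const k 0) (*-zeroʳ k))) 0<∑f)

sum-factorˡ : (a : ℕ) {f g : Fin k → ℕ} → (∀ x → f x ≡ a * g x) → sum f ≡ a * sum g
sum-factorˡ a {g = g} f≡a*g = trans (sum-cong-≗ f≡a*g) (sym (*-distribˡ-sum a g))

∑-*-∑-comm : (f : Fin k → ℕ) (g : Fin k → Fin l → ℕ) →
             ∑[ x < k ] (f x * sum (g x)) ≡ ∑[ i < l ] ∑[ x < k ] (f x * g x i)
∑-*-∑-comm f g = trans (sum-cong-≗ λ x → *-distribˡ-sum (f x) (g x)) (∑-comm λ x i → f x * g x i)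

χ : ∀ {n} → Subset n → Fin n → ℕ
χ p x with lookup p x
... | true  = 1
... | false = 0

χ∁ : ∀ {n} → Subset n → Fin n → ℕ
χ∁ p x = 1 ∸ χ p x

module _ {n} (p : Subset n) (x : Fin n) where

  χ-0∨1 : χ p x ≡ 0 ⊎ χ p x ≡ 1
  χ-0∨1 with lookup p x
  ... | true  = inj₂ refl
  ... | false = inj₁ refl

  χ≤1 : χ p x ≤ 1
  χ≤1 with lookup p x
  ... | true  = ≤-refl
  ... | false = z≤n

  χ-idem : χ p x * χ p x ≡ χ p x
  χ-idem with lookup p x
  ... | true  = refl
  ... | false = refl

  χ+χ∁≡1 : χ p x + χ∁ p x ≡ 1
  χ+χ∁≡1 with lookup p x
  ... | true  = refl
  ... | false = refl

  0<χ⇒χ≡1 : 0 < χ p x → χ p x ≡ 1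
  0<χ⇒χ≡1 0<χ with lookup p x
  ... | true = refl

  ∈⇒χ≡1 : x ∈ p → χ p x ≡ 1
  ∈⇒χ≡1 x∈p with lookup p x | []=⇒lookup x∈p
  ... | true | _ = refl

  χ≡1⇒∈ : χ p x ≡ 1 → x ∈ p
  χ≡1⇒∈ χ≡1 = lookup⇒[]= x p (lookup≡true χ≡1)
    where
    lookup≡true : χ p x ≡ 1 → lookup p x ≡ true
    lookup≡true _ with lookup p x
    ... | true = refl

∣p∣≡sumχ : ∀ {n} (p : Subset n) → ∣ p ∣ ≡ sum (χ p)
∣p∣≡sumχ []          = refl
∣p∣≡sumχ (true ∷ p)  = cong suc (∣p∣≡sumχ p)
∣p∣≡sumχ (false ∷ p) = ∣p∣≡sumχ p

χ≡χ⇔∈⇔∈ : ∀ {n n'} (p : Subset n) i (p' : Subset n') x → (χ p i ≡ χ p' x) ⇔ (i ∈ p ⇔ x ∈ p')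
χ≡χ⇔∈⇔∈ p i p' x = mk⇔ to from
  where
  to : χ p i ≡ χ p' x → (i ∈ p ⇔ x ∈ p')
  to eq = mk⇔ (λ i∈p → χ≡1⇒∈ p' x (trans (sym eq) (∈⇒χ≡1 p i i∈p)))
              (λ x∈p' → χ≡1⇒∈ p i (trans eq (∈⇒χ≡1 p' x x∈p')))
  from : (i ∈ p ⇔ x ∈ p') → χ p i ≡ χ p' x
  from iff with χ-0∨1 p i | χ-0∨1 p' x
  ... | inj₁ pi≡0 | inj₁ p'x≡0 = trans pi≡0 (sym p'x≡0)
  ... | inj₂ pi≡1 | inj₂ p'x≡1 = trans pi≡1 (sym p'x≡1)
  ... | inj₁ pi≡0 | inj₂ p'x≡1 = ⊥-elim (0≢1+n (trans (sym pi≡0) (∈⇒χ≡1 p i (Equivalence.from iff (χ≡1⇒∈ p' x p'x≡1)))))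
  ... | inj₂ pi≡1 | inj₁ p'x≡0 = ⊥-elim (0≢1+n (trans (sym p'x≡0) (∈⇒χ≡1 p' x (Equivalence.to iff (χ≡1⇒∈ p i pi≡1)))))

χ*χ≡0⊎χ≡1×χ≡1 : ∀ {n n'} (p : Subset n) x (p' : Subset n') y →
                χ p x * χ p' y ≡ 0 ⊎ (χ p x ≡ 1 × χ p' y ≡ 1)
χ*χ≡0⊎χ≡1×χ≡1 p x p' y with χ-0∨1 p x | χ-0∨1 p' y
... | inj₁ χ≡0 | _         = inj₁ (cong (_* χ p' y) χ≡0)
... | inj₂ χ≡1 | inj₁ χ'≡0 = inj₁ (trans (cong (χ p x *_) χ'≡0) (*-zeroʳ (χ p x)))
... | inj₂ χ≡1 | inj₂ χ'≡1 = inj₂ (χ≡1 , χ'≡1)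

private
  gap₁ : ∀ a e → 2 * a * (a + e) + e * e ≡ a * a + (a + e) * (a + e)
  gap₁ = solve-∀
  gap₂ : ∀ b e → 2 * (b + e) * b + e * e ≡ (b + e) * (b + e) + b * b
  gap₂ = solve-∀

  gap-zero : ∀ {s t} e → s + e * e ≡ t → s ≡ t → e ≡ 0
  gap-zero     zero    _   _   = refl
  gap-zero {s} (suc e) gap s≡t = contradiction (+-cancelˡ-≡ s _ 0 (trans gap (trans (sym s≡t) (sym (+-identityʳ s))))) λ ()

2*a*b≤a*a+b*b : ∀ a b → 2 * a * b ≤ a * a + b * b
2*a*b≤a*a+b*b a b with ≤-total a b
... | inj₁ a≤b with m≤n⇒∃[o]m+o≡n a≤b
...   | e , refl = subst (2 * a * (a + e) ≤_) (gap₁ a e) (m≤m+n _ (e * e))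
2*a*b≤a*a+b*b a b | inj₂ b≤a with m≤n⇒∃[o]m+o≡n b≤a
...   | e , refl = subst (2 * (b + e) * b ≤_) (gap₂ b e) (m≤m+n _ (e * e))

2*a*b≡a*a+b*b⇒a≡b : ∀ a b → 2 * a * b ≡ a * a + b * b → a ≡ b
2*a*b≡a*a+b*b⇒a≡b a b eq with ≤-total a b
... | inj₁ a≤b with m≤n⇒∃[o]m+o≡n a≤b
...   | e , refl = sym (trans (cong (a +_) (gap-zero e (gap₁ a e) eq)) (+-identityʳ a))
2*a*b≡a*a+b*b⇒a≡b a b eq | inj₂ b≤a with m≤n⇒∃[o]m+o≡n b≤a
...   | e , refl = trans (cong (b +_) (gap-zero e (gap₂ b e) eq)) (+-identityʳ b)

+-offsets-≤ : ∀ {a b x y u v} → a + x ≡ u → b + y ≡ v → a ≤ b → u + y ≤ v + x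
+-offsets-≤ {a} {b} {x} {y} refl refl a≤b = begin
  a + x + y  ≡⟨ +-assoc a x y ⟩
  a + (x + y) ≤⟨ +-monoˡ-≤ (x + y) a≤b ⟩
  b + (x + y) ≡⟨ cong (b +_) (+-comm x y) ⟩
  b + (y + x) ≡⟨ +-assoc b y x ⟨
  b + y + x  ∎
  where open ≤-Reasoning

+-offsets-≡ : ∀ {a b x y u v} → a + x ≡ u → b + y ≡ v → u + y ≡ v + x → a ≡ b
+-offsets-≡ {a} {b} {x} {y} refl refl eq = +-cancelʳ-≡ (x + y) a b (begin
  a + (x + y) ≡⟨ +-assoc a x y ⟨
  a + x + y   ≡⟨ eq ⟩
  b + y + x   ≡⟨ +-assoc b y x ⟩
  b + (y + x) ≡⟨ cong (b +_) (+-comm y x) ⟩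
  b + (x + y) ∎)
  where open ≡-Reasoning

-- The defect  A₂ + N (q+1)² − 2 (q+1) A₁ = Σ_{L ∉ C} (n L − (q+1))²  equals
-- (q² − m) (m² − (q² + 2q + 2) m + q⁴ + q³ + q + 1), whose second factor is positive.
module CliqueSizeArithmetic (q m A₁ A₂ N : ℕ)
  (∑n : A₁ + m * (m + q) ≡ q * q * (m * (q + 1)))
  (∑n² : A₂ + m * (m + q) * (m + q) + m * (m + q) ≡ m * (q + 1) * (m * (q + 1)) + q * q * (m * (m + q)))
  (∑1 : (N + m) * (q + 1) ≡ (q ^ 3 + 1) * (q * q)) where

  private
    U V : ℕ
    U = 2 * (q + 1) * (q * q * (m * (q + 1))) + (m * (m + q) * (m + q) + m * (m + q) + m * ((q + 1) * (q + 1)))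
    V = m * (q + 1) * (m * (q + 1)) + q * q * (m * (m + q)) + (q ^ 3 + 1) * (q * q) * (q + 1) + 2 * (q + 1) * (m * (m + q))

    lhs-offset : 2 * (q + 1) * A₁ + 2 * (q + 1) * (m * (m + q)) ≡ 2 * (q + 1) * (q * q * (m * (q + 1)))
    lhs-offset = trans (sym (*-distribˡ-+ (2 * (q + 1)) A₁ _)) (cong (2 * (q + 1) *_) ∑n)

    rhs-offset : A₂ + N * ((q + 1) * (q + 1)) + (m * (m + q) * (m + q) + m * (m + q) + m * ((q + 1) * (q + 1)))
               ≡ m * (q + 1) * (m * (q + 1)) + q * q * (m * (m + q)) + (q ^ 3 + 1) * (q * q) * (q + 1)
    rhs-offset = trans (regroup A₂ N (m * (m + q)) (m + q) m (q + 1))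
                       (cong₂ _+_ ∑n² (cong (_* (q + 1)) ∑1))
      where
      regroup : ∀ a n k l m Q → a + n * (Q * Q) + (k * l + k + m * (Q * Q)) ≡ a + k * l + k + (n + m) * Q * Q
      regroup = solve-∀

    surplus : ∀ s t → let q = 3 + s ; m = 1 + q * q + t in
      2 * (q + 1) * (q * q * (m * (q + 1))) + (m * (m + q) * (m + q) + m * (m + q) + m * ((q + 1) * (q + 1)))
      ≡ m * (q + 1) * (m * (q + 1)) + q * q * (m * (m + q)) + (q * (q * (q * 1)) + 1) * (q * q) * (q + 1) + 2 * (q + 1) * (m * (m + q))
        + suc t * ((3 + s) * (14 + 20 * s + 8 * s * s + s * s * s) + (3 + s) * (1 + s) * t + t * t)
    surplus = solve-∀

    balance : ∀ q → let m = q * q in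
      2 * (q + 1) * (q * q * (m * (q + 1))) + (m * (m + q) * (m + q) + m * (m + q) + m * ((q + 1) * (q + 1)))
      ≡ m * (q + 1) * (m * (q + 1)) + q * q * (m * (m + q)) + (q * (q * (q * 1)) + 1) * (q * q) * (q + 1) + 2 * (q + 1) * (m * (m + q))
    balance = solve-∀

  clique-size-≤ : 2 < q → 2 * (q + 1) * A₁ ≤ A₂ + N * ((q + 1) * (q + 1)) → m ≤ q * q
  clique-size-≤ 2<q defect≥0 with m ≤? q * q
  ... | yes m≤q² = m≤q²
  ... | no  m≰q² with m≤n⇒∃[o]m+o≡n 2<q | m≤n⇒∃[o]m+o≡n (≰⇒> m≰q²)
  ...   | s , refl | t , refl = ⊥-elim (<⇒≱ (subst (V <_) (sym (surplus s t)) (m<m+n V (s≤s z≤n)))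
                                           (+-offsets-≤ lhs-offset rhs-offset defect≥0))

  defect-zero : m ≡ q * q → 2 * (q + 1) * A₁ ≡ A₂ + N * ((q + 1) * (q + 1))
  defect-zero refl = +-offsets-≡ lhs-offset rhs-offset (balance q)

v*v≡q*v⇒v≡q : ∀ {v q} → 0 < v → v * v ≡ q * v → v ≡ q
v*v≡q*v⇒v≡q {suc v} {q} _ eq = *-cancelʳ-≡ (suc v) q (suc v) eq

a*k<a⇒k≡0 : ∀ a k → a * k < a → k ≡ 0
a*k<a⇒k≡0 a zero    _  = refl
a*k<a⇒k≡0 a (suc k) lt = ⊥-elim (<⇒≱ lt (m≤m*n a (suc k)))

sign : ℕ → ℕ
sign zero    = 0
sign (suc _) = 1

sign-q+1 : ∀ q → sign (q + 1) ≡ 1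
sign-q+1 q rewrite +-comm q 1 = refl

sign≤ : ∀ {v} k → (k ≡ 0 → v ≡ 0) → sign v ≤ k
sign≤ {zero}  _       _   = z≤n
sign≤ {suc _} zero    k≡0 = contradiction (k≡0 refl) λ ()
sign≤ {suc _} (suc _) _   = s≤s z≤n

0<v⇒sign≡1 : ∀ {v} → 0 < v → sign v ≡ 1
0<v⇒sign≡1 {suc _} _ = refl

m<n+1⇒m≤n : ∀ {m n} → m < n + 1 → m ≤ n
m<n+1⇒m≤n {m} {n} m<n+1 = m<1+n⇒m≤n (subst (m <_) (+-comm n 1) m<n+1)

0-1-or-q+1 : ∀ {v q} → v ≤ q + 1 → (2 ≤ v → v ≤ q → ⊥) → v ≡ 0 ⊎ v ≡ 1 ⊎ v ≡ q + 1
0-1-or-q+1 {0}               _      _    = inj₁ refl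
0-1-or-q+1 {1}               _      _    = inj₂ (inj₁ refl)
0-1-or-q+1 {v@(suc (suc _))} {q} v≤q+1 ¬mid with v ≟ q + 1
... | yes v≡q+1 = inj₂ (inj₂ v≡q+1)
... | no  v≢q+1 = ⊥-elim (¬mid (s≤s (s≤s z≤n)) (m<n+1⇒m≤n (≤∧≢⇒< v≤q+1 v≢q+1)))

sign-on-three-values : ∀ q v → v ≡ 0 ⊎ v ≡ 1 ⊎ v ≡ q + 1 → (q + 1) * sign v + v * v ≡ (q + 2) * v
sign-on-three-values q _ (inj₁ refl)        = trans (+-identityʳ _) (trans (*-zeroʳ (q + 1)) (sym (*-zeroʳ (q + 2))))
sign-on-three-values q _ (inj₂ (inj₁ refl)) = at-1 q
  where
  at-1 : ∀ q → (q + 1) * 1 + 1 * 1 ≡ (q + 2) * 1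
  at-1 = solve-∀
sign-on-three-values q _ (inj₂ (inj₂ refl)) rewrite sign-q+1 q = at-q+1 q
  where
  at-q+1 : ∀ q → (q + 1) * 1 + (q + 1) * (q + 1) ≡ (q + 2) * (q + 1)
  at-q+1 = solve-∀

-- Below, k is the number of clique blocks through a fixed point u of degree j and a point x of
-- degree v, so that 1 ∸ k indicates that no clique block joins x to u.
far-weight-bound : ∀ k v j q → (k ≡ 0 → 0 < v → v + j ≤ q + 1) →
                   (1 ∸ k) * v + j * ((1 ∸ k) * sign v) ≤ (q + 1) * ((1 ∸ k) * sign v)
far-weight-bound (suc k) v       j q _ rewrite 0∸n≡0 k | *-zeroʳ j | *-zeroʳ (q + 1) = z≤n
far-weight-bound zero    zero    j q _ rewrite *-zeroʳ j | *-zeroʳ (q + 1) = z≤n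
far-weight-bound zero    (suc v) j q h rewrite +-identityʳ v | *-identityʳ j | *-identityʳ (q + 1) = h refl (s≤s z≤n)

far-sign-bound : ∀ k v → k ≤ 1 → k ≤ v → (1 ∸ k) * sign v + k ≤ sign v
far-sign-bound 0 v       _ _ = ≤-reflexive (trans (+-identityʳ _) (*-identityˡ (sign v)))
far-sign-bound 1 (suc _) _ _ = ≤-refl
far-sign-bound 1 zero    _ ()
far-sign-bound (suc (suc _)) _ (s≤s ()) _

private
  middle-degree-identity : ∀ a e → let j = 2 + a ; q = j + e in
    q * q * (q + 1) + j * j ≡ (1 + e) * (q * (1 + e)) + j * (q * q + q) + j + (1 + e) * (a * (2 + a + e) + e)
  middle-degree-identity = solve-∀

  middle-degree-surplus : ∀ a e → 2 < 2 + a + e → 0 < (1 + e) * (a * (2 + a + e) + e)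
  middle-degree-surplus zero    zero    (s≤s (s≤s ()))
  middle-degree-surplus zero    (suc e) _ = s≤s z≤n
  middle-degree-surplus (suc a) e       _ = s≤s z≤n

-- For a point u of degree j, X sums the degrees and Y counts the points of positive degree among the
-- points joined to u by no clique block; Z is the number of points of positive degree.
middle-degree-impossible : ∀ q j X Y Z → 2 < q → 2 ≤ j → j ≤ q →
  X + j * (q * q + q) + j ≡ q * q * (q + 1) + j * j →
  X + j * Y ≤ (q + 1) * Y →
  Y + j * (q + 1) + 1 ≤ Z + j →
  Z ≤ q * q + q + 1 → ⊥
middle-degree-impossible q j X Y Z 2<q 2≤j j≤q eqX X≤ Y≤ Z≤
  with m≤n⇒∃[o]m+o≡n 2≤j
... | a , refl with m≤n⇒∃[o]m+o≡n j≤q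
...   | e , refl = <-irrefl refl (begin-strict
  X + j * (q * q + q) + j                                                  ≤⟨ +-monoˡ-≤ j (+-monoˡ-≤ (j * (q * q + q)) X≤[1+e]²q) ⟩
  (1 + e) * (q * (1 + e)) + j * (q * q + q) + j                            <⟨ m<m+n _ (middle-degree-surplus a e 2<q) ⟩
  (1 + e) * (q * (1 + e)) + j * (q * q + q) + j + (1 + e) * (a * (2 + a + e) + e) ≡⟨ middle-degree-identity a e ⟨
  q * q * (q + 1) + j * j                                                  ≡⟨ eqX ⟨
  X + j * (q * q + q) + j                                                  ∎)
  where
  open ≤-Reasoning
  Y≤q[1+e] : Y ≤ q * (1 + e)
  Y≤q[1+e] = +-cancelʳ-≤ (j * (q + 1) + 1) Y (q * (1 + e)) (begin
    Y + (j * (q + 1) + 1)          ≡⟨ +-assoc Y _ 1 ⟨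
    Y + j * (q + 1) + 1            ≤⟨ Y≤ ⟩
    Z + j                          ≤⟨ +-monoˡ-≤ j Z≤ ⟩
    q * q + q + 1 + j              ≡⟨ regroup a e ⟩
    q * (1 + e) + (j * (q + 1) + 1) ∎)
    where
    regroup : ∀ a e → let j = 2 + a ; q = j + e in q * q + q + 1 + j ≡ q * (1 + e) + (j * (q + 1) + 1)
    regroup = solve-∀
  X≤[1+e]²q : X ≤ (1 + e) * (q * (1 + e))
  X≤[1+e]²q = ≤-trans (+-cancelʳ-≤ (j * Y) X ((1 + e) * Y) (subst (X + j * Y ≤_) (split a e Y) X≤))
                      (*-monoʳ-≤ (1 + e) Y≤q[1+e])
    where
    split : ∀ a e Y → (2 + a + e + 1) * Y ≡ (1 + e) * Y + (2 + a) * Y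
    split = solve-∀

support-size-impossible : ∀ q Z → 2 < q →
  (q + 1) * Z + q * q * (q * q + q) ≡ (q + 2) * (q * q * (q + 1)) → Z ≤ q * q + q + 1 → ⊥
support-size-impossible q Z 2<q eq Z≤ with m≤n⇒∃[o]m+o≡n 2<q
... | s , refl = <⇒≱ (subst (q * q + q + 1 <_) (sym Z≡2q²) (subst (q * q + q + 1 <_) (excess s) (m<m+n _ (s≤s z≤n)))) Z≤
  where
  excess : ∀ s → let q = 3 + s in q * q + q + 1 + (5 + 5 * s + s * s) ≡ 2 * q * q
  excess = solve-∀
  balance : ∀ q → (q + 2) * (q * q * (q + 1)) ≡ (q + 1) * (2 * q * q) + q * q * (q * q + q)
  balance = solve-∀
  Z≡2q² : Z ≡ 2 * q * q
  Z≡2q² = *-cancelˡ-≡ Z (2 * q * q) (q + 1) (+-cancelʳ-≡ (q * q * (q * q + q)) _ _ (trans eq (balance q)))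

replication-number : ∀ q r → 0 < q → r * (q + 1) + 1 ≡ (q ^ 3 + 1) * 1 + r → r ≡ q * q
replication-number q@(suc _) r _ eq = *-cancelʳ-≡ r (q * q) q (+-cancelʳ-≡ (r + 1) _ _ (begin
  r * q + (r + 1)      ≡⟨ lhs q r ⟩
  r * (q + 1) + 1      ≡⟨ eq ⟩
  (q ^ 3 + 1) * 1 + r  ≡⟨ rhs q r ⟩
  q * q * q + (r + 1)  ∎))
  where
  open ≡-Reasoning
  lhs : ∀ q r → r * q + (r + 1) ≡ r * (q + 1) + 1
  lhs = solve-∀
  rhs : ∀ q r → (q * (q * (q * 1)) + 1) * 1 + r ≡ q * q * q + (r + 1)
  rhs = solve-∀

module UnitalCounting {q} (U : Unital q) (q>0 : 0 < q) where
  open Unital U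

  inc : Fin b → Fin (q ^ 3 + 1) → ℕ
  inc i = χ (block i)

  ∑inc≡q+1 : ∀ i → sum (inc i) ≡ q + 1
  ∑inc≡q+1 i = trans (sym (∣p∣≡sumχ (block i))) (block-size i)

  private
    on-both : ∀ {i j x y} → x ≢ y → inc i x ≡ 1 → inc i y ≡ 1 → inc j x ≡ 1 → inc j y ≡ 1 → i ≡ j
    on-both {i} {j} {x} {y} x≢y ix iy jx jy =
      unique x y x≢y i j (χ≡1⇒∈ _ _ ix) (χ≡1⇒∈ _ _ iy) (χ≡1⇒∈ _ _ jx) (χ≡1⇒∈ _ _ jy)

  joins : Fin (q ^ 3 + 1) → Fin (q ^ 3 + 1) → ℕ
  joins x y = ∑[ i < b ] (inc i x * inc i y)

  joined-once : ∀ {x y} → x ≢ y → joins x y ≡ 1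
  joined-once {x} {y} x≢y with joined x y x≢y
  ... | i₀ , x∈i₀ , y∈i₀ = trans (sum-single i₀ others) (cong₂ _*_ i₀x i₀y)
    where
    i₀x : inc i₀ x ≡ 1
    i₀x = ∈⇒χ≡1 (block i₀) x x∈i₀
    i₀y : inc i₀ y ≡ 1
    i₀y = ∈⇒χ≡1 (block i₀) y y∈i₀
    others : ∀ i → i ≢ i₀ → inc i x * inc i y ≡ 0
    others i i≢i₀ with χ*χ≡0⊎χ≡1×χ≡1 (block i) x (block i) y
    ... | inj₁ ≡0        = ≡0
    ... | inj₂ (ix , iy) = contradiction (on-both x≢y ix iy i₀x i₀y) i≢i₀

  meet-once : ∀ {i j x₀} → i ≢ j → inc i x₀ ≡ 1 → inc j x₀ ≡ 1 → ∑[ x < q ^ 3 + 1 ] (inc i x * inc j x) ≡ 1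
  meet-once {i} {j} {x₀} i≢j ix₀ jx₀ = trans (sum-single x₀ others) (cong₂ _*_ ix₀ jx₀)
    where
    others : ∀ x → x ≢ x₀ → inc i x * inc j x ≡ 0
    others x x≢x₀ with χ*χ≡0⊎χ≡1×χ≡1 (block i) x (block j) x
    ... | inj₁ ≡0        = ≡0
    ... | inj₂ (ix , jx) = contradiction (on-both x≢x₀ ix ix₀ jx jx₀) i≢j

  replication : ∀ x → ∑[ i < b ] inc i x ≡ q * q
  replication x = replication-number q r q>0 (begin
    r * (q + 1) + 1                        ≡⟨ cong (_+ 1) ∑joins≡r*[q+1] ⟨
    sum (joins x) + 1                      ≡⟨ sum-≡-except x (λ y y≢x → joined-once (y≢x ∘ sym)) ⟩
    ∑[ y < q ^ 3 + 1 ] 1 + joins x x       ≡⟨ cong₂ _+_ (sum-const (q ^ 3 + 1) 1) (sum-cong-≗ λ i → χ-idem (block i) x) ⟩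
    (q ^ 3 + 1) * 1 + r                    ∎)
    where
    open ≡-Reasoning
    r : ℕ
    r = ∑[ i < b ] inc i x
    ∑joins≡r*[q+1] : sum (joins x) ≡ r * (q + 1)
    ∑joins≡r*[q+1] = begin
      sum (joins x)                                     ≡⟨ ∑-comm (λ y i → inc i x * inc i y) ⟩
      ∑[ i < b ] ∑[ y < q ^ 3 + 1 ] (inc i x * inc i y) ≡⟨ sum-cong-≗ (λ i → *-distribˡ-sum (inc i x) (inc i)) ⟨
      ∑[ i < b ] (inc i x * sum (inc i))                ≡⟨ sum-cong-≗ (λ i → cong (inc i x *_) (∑inc≡q+1 i)) ⟩
      ∑[ i < b ] (inc i x * (q + 1))                    ≡⟨ *-distribʳ-sum (q + 1) (λ i → inc i x) ⟨
      r * (q + 1)                                       ∎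

  block-count : b * (q + 1) ≡ (q ^ 3 + 1) * (q * q)
  block-count = begin
    b * (q + 1)                         ≡⟨ sum-const b (q + 1) ⟨
    ∑[ i < b ] (q + 1)                  ≡⟨ sum-cong-≗ ∑inc≡q+1 ⟨
    ∑[ i < b ] sum (inc i)              ≡⟨ ∑-comm inc ⟩
    ∑[ x < q ^ 3 + 1 ] ∑[ i < b ] inc i x ≡⟨ sum-cong-≗ replication ⟩
    ∑[ x < q ^ 3 + 1 ] (q * q)          ≡⟨ sum-const (q ^ 3 + 1) (q * q) ⟩
    (q ^ 3 + 1) * (q * q)               ∎
    where open ≡-Reasoning

  joins-self : ∀ x → joins x x ≡ q * q
  joins-self x = trans (sum-cong-≗ λ i → χ-idem (block i) x) (replication x)

  block-sum : (Fin (q ^ 3 + 1) → ℕ) → Fin b → ℕ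
  block-sum f L = ∑[ x < q ^ 3 + 1 ] (inc L x * f x)

  ∑-over-blocks : (f : Fin (q ^ 3 + 1) → ℕ) → ∑[ L < b ] block-sum f L ≡ q * q * sum f
  ∑-over-blocks f = begin
    ∑[ L < b ] ∑[ x < q ^ 3 + 1 ] (inc L x * f x)  ≡⟨ ∑-comm (λ L x → inc L x * f x) ⟩
    ∑[ x < q ^ 3 + 1 ] ∑[ L < b ] (inc L x * f x)  ≡⟨ sum-cong-≗ (λ x → *-distribʳ-sum (f x) λ L → inc L x) ⟨
    ∑[ x < q ^ 3 + 1 ] (sum (λ L → inc L x) * f x) ≡⟨ sum-cong-≗ (λ x → cong (_* f x) (replication x)) ⟩
    ∑[ x < q ^ 3 + 1 ] (q * q * f x)               ≡⟨ *-distribˡ-sum (q * q) f ⟨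
    q * q * sum f                                  ∎
    where open ≡-Reasoning

  ∑-square-over-blocks : (f : Fin (q ^ 3 + 1) → ℕ) →
    ∑[ L < b ] (block-sum f L * block-sum f L) + ∑[ x < q ^ 3 + 1 ] (f x * f x)
    ≡ sum f * sum f + q * q * ∑[ x < q ^ 3 + 1 ] (f x * f x)
  ∑-square-over-blocks f = begin
    ∑[ L < b ] (block-sum f L * block-sum f L) + sum f²    ≡⟨ cong (_+ sum f²) ∑block-sum²≡∑∑joins ⟩
    ∑[ x < P ] ∑[ y < P ] (f x * f y * joins x y) + sum f² ≡⟨ ∑-distrib-+ (λ x → ∑[ y < P ] (f x * f y * joins x y)) f² ⟨
    ∑[ x < P ] (∑[ y < P ] (f x * f y * joins x y) + f² x) ≡⟨ sum-cong-≗ row ⟩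
    ∑[ x < P ] (f x * sum f + q * q * f² x)                ≡⟨ ∑-distrib-+ (λ x → f x * sum f) (λ x → q * q * f² x) ⟩
    ∑[ x < P ] (f x * sum f) + ∑[ x < P ] (q * q * f² x)   ≡⟨ cong₂ _+_ (*-distribʳ-sum (sum f) f) (*-distribˡ-sum (q * q) f²) ⟨
    sum f * sum f + q * q * sum f²                         ∎
    where
    open ≡-Reasoning
    P = q ^ 3 + 1
    f² : Fin P → ℕ
    f² x = f x * f x
    ∑block-sum²≡∑∑joins : ∑[ L < b ] (block-sum f L * block-sum f L) ≡ ∑[ x < P ] ∑[ y < P ] (f x * f y * joins x y)
    ∑block-sum²≡∑∑joins = begin
      ∑[ L < b ] (block-sum f L * block-sum f L)
        ≡⟨ sum-cong-≗ (λ L → *-distribʳ-sum (block-sum f L) λ x → inc L x * f x) ⟩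
      ∑[ L < b ] ∑[ x < P ] (inc L x * f x * block-sum f L)
        ≡⟨ ∑-comm (λ L x → inc L x * f x * block-sum f L) ⟩
      ∑[ x < P ] ∑[ L < b ] (inc L x * f x * block-sum f L)
        ≡⟨ sum-cong-≗ (λ x → ∑-*-∑-comm (λ L → inc L x * f x) λ L y → inc L y * f y) ⟩
      ∑[ x < P ] ∑[ y < P ] ∑[ L < b ] (inc L x * f x * (inc L y * f y))
        ≡⟨ sum-cong-≗ (λ x → sum-cong-≗ λ y → sum-factorˡ (f x * f y) λ L → regroup (inc L x) (f x) (inc L y) (f y)) ⟩
      ∑[ x < P ] ∑[ y < P ] (f x * f y * joins x y)
        ∎
      where
      regroup : ∀ a u a' u' → a * u * (a' * u') ≡ u * u' * (a * a')
      regroup = solve-∀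
    row : ∀ x → ∑[ y < P ] (f x * f y * joins x y) + f² x ≡ f x * sum f + q * q * f² x
    row x = begin
      ∑[ y < P ] (f x * f y * joins x y) + f² x
        ≡⟨ sum-≡-except x (λ y y≢x → trans (cong (f x * f y *_) (joined-once (y≢x ∘ sym))) (*-identityʳ _)) ⟩
      ∑[ y < P ] (f x * f y) + f² x * joins x x
        ≡⟨ cong₂ _+_ (*-distribˡ-sum (f x) f) (cong (f² x *_) (sym (joins-self x))) ⟨
      f x * sum f + f² x * (q * q)
        ≡⟨ cong (f x * sum f +_) (*-comm (f² x) (q * q)) ⟩
      f x * sum f + q * q * f² x
        ∎

  module Clique (C : Subset b) (clique : IsClique U C) where

    c : Fin b → ℕ
    c = χ C

    m : ℕ
    m = sum c

    d : Fin (q ^ 3 + 1) → ℕ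
    d x = ∑[ i < b ] (c i * inc i x)

    n : Fin b → ℕ
    n = block-sum d

    clique-meet-once : ∀ {i j} → c i ≡ 1 → c j ≡ 1 → i ≢ j → ∑[ x < q ^ 3 + 1 ] (inc i x * inc j x) ≡ 1
    clique-meet-once {i} {j} ci cj i≢j with clique i j (χ≡1⇒∈ C i ci) (χ≡1⇒∈ C j cj)
    ... | x₀ , x₀∈i , x₀∈j = meet-once i≢j (∈⇒χ≡1 (block i) x₀ x₀∈i) (∈⇒χ≡1 (block j) x₀ x₀∈j)

    n-clique : ∀ {i} → c i ≡ 1 → n i ≡ m + q
    n-clique {i} ci = +-cancelʳ-≡ 1 _ _ (begin
      n i + 1          ≡⟨ cong₂ _+_ n≡∑T (sym ci) ⟩
      sum T + c i      ≡⟨ sum-≡-except i T≡c ⟩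
      m + T i          ≡⟨ cong (m +_) Tᵢ ⟩
      m + (q + 1)      ≡⟨ +-assoc m q 1 ⟨
      m + q + 1        ∎)
      where
      open ≡-Reasoning
      T : Fin b → ℕ
      T j = c j * ∑[ x < q ^ 3 + 1 ] (inc i x * inc j x)
      n≡∑T : n i ≡ sum T
      n≡∑T = trans (∑-*-∑-comm (inc i) (λ x j → c j * inc j x))
                   (sum-cong-≗ λ j → sum-factorˡ (c j) λ x → x*[y*z]≡y*[x*z] (inc i x) (c j) (inc j x))
        where
        x*[y*z]≡y*[x*z] : ∀ x y z → x * (y * z) ≡ y * (x * z)
        x*[y*z]≡y*[x*z] = solve-∀
      T≡c : ∀ j → j ≢ i → T j ≡ c j
      T≡c j j≢i with χ-0∨1 C j
      ... | inj₁ cj≡0 = trans (cong (_* _) cj≡0) (sym cj≡0)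
      ... | inj₂ cj≡1 = trans (cong₂ _*_ cj≡1 (clique-meet-once ci cj≡1 (j≢i ∘ sym))) (sym cj≡1)
      Tᵢ : T i ≡ q + 1
      Tᵢ = trans (cong₂ _*_ ci (sum-cong-≗ λ x → χ-idem (block i) x)) (trans (*-identityˡ _) (∑inc≡q+1 i))

    c*f[n]≡c*f[m+q] : (f : ℕ → ℕ) → ∀ i → c i * f (n i) ≡ c i * f (m + q)
    c*f[n]≡c*f[m+q] f i with χ-0∨1 C i
    ... | inj₁ ci≡0 = trans (cong (_* f (n i)) ci≡0) (cong (_* f (m + q)) (sym ci≡0))
    ... | inj₂ ci≡1 = cong (λ v → c i * f v) (n-clique ci≡1)

    ∑d≡m*[q+1] : sum d ≡ m * (q + 1)
    ∑d≡m*[q+1] = begin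
      ∑[ x < q ^ 3 + 1 ] ∑[ i < b ] (c i * inc i x)  ≡⟨ ∑-comm (λ x i → c i * inc i x) ⟩
      ∑[ i < b ] ∑[ x < q ^ 3 + 1 ] (c i * inc i x)  ≡⟨ sum-cong-≗ (λ i → *-distribˡ-sum (c i) (inc i)) ⟨
      ∑[ i < b ] (c i * sum (inc i))                 ≡⟨ sum-cong-≗ (λ i → cong (c i *_) (∑inc≡q+1 i)) ⟩
      ∑[ i < b ] (c i * (q + 1))                     ≡⟨ *-distribʳ-sum (q + 1) c ⟨
      m * (q + 1)                                    ∎
      where open ≡-Reasoning

    ∑d²≡m*[m+q] : ∑[ x < q ^ 3 + 1 ] (d x * d x) ≡ m * (m + q)
    ∑d²≡m*[m+q] = begin
      ∑[ x < q ^ 3 + 1 ] (d x * d x)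
        ≡⟨ ∑-*-∑-comm d (λ x i → c i * inc i x) ⟩
      ∑[ i < b ] ∑[ x < q ^ 3 + 1 ] (d x * (c i * inc i x))
        ≡⟨ sum-cong-≗ (λ i → sum-factorˡ (c i) λ x → x*[y*z]≡y*[z*x] (d x) (c i) (inc i x)) ⟩
      ∑[ i < b ] (c i * n i)
        ≡⟨ sum-cong-≗ (c*f[n]≡c*f[m+q] λ v → v) ⟩
      ∑[ i < b ] (c i * (m + q))
        ≡⟨ *-distribʳ-sum (m + q) c ⟨
      m * (m + q)
        ∎
      where
      open ≡-Reasoning
      x*[y*z]≡y*[z*x] : ∀ x y z → x * (y * z) ≡ y * (z * x)
      x*[y*z]≡y*[z*x] = solve-∀

    c∁ : Fin b → ℕ
    c∁ = χ∁ C

    N A₁ A₂ : ℕ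
    N = sum c∁
    A₁ = ∑[ L < b ] (c∁ L * n L)
    A₂ = ∑[ L < b ] (c∁ L * (n L * n L))

    split : (f : Fin b → ℕ) → sum f ≡ ∑[ L < b ] (c L * f L) + ∑[ L < b ] (c∁ L * f L)
    split f = trans (sum-cong-≗ λ L → trans (sym (*-identityˡ (f L)))
                                             (trans (cong (_* f L) (sym (χ+χ∁≡1 C L))) (*-distribʳ-+ (f L) (c L) (c∁ L))))
                    (∑-distrib-+ (λ L → c L * f L) (λ L → c∁ L * f L))

    ∑-over-C : (f : ℕ → ℕ) → ∑[ L < b ] (c L * f (n L)) ≡ m * f (m + q)
    ∑-over-C f = trans (sum-cong-≗ (c*f[n]≡c*f[m+q] f)) (sym (*-distribʳ-sum (f (m + q)) c))

    ∑n-outside : A₁ + m * (m + q) ≡ q * q * (m * (q + 1))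
    ∑n-outside = begin
      A₁ + m * (m + q)                       ≡⟨ +-comm A₁ _ ⟩
      m * (m + q) + A₁                       ≡⟨ cong (_+ A₁) (∑-over-C λ v → v) ⟨
      ∑[ L < b ] (c L * n L) + A₁            ≡⟨ split n ⟨
      sum n                                  ≡⟨ ∑-over-blocks d ⟩
      q * q * sum d                          ≡⟨ cong (q * q *_) ∑d≡m*[q+1] ⟩
      q * q * (m * (q + 1))                  ∎
      where open ≡-Reasoning

    ∑n²-outside : A₂ + m * (m + q) * (m + q) + m * (m + q) ≡ m * (q + 1) * (m * (q + 1)) + q * q * (m * (m + q))
    ∑n²-outside = begin
      A₂ + m * (m + q) * (m + q) + m * (m + q)                  ≡⟨ cong₂ _+_ ∑n²-split (sym ∑d²≡m*[m+q]) ⟩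
      ∑[ L < b ] (n L * n L) + ∑[ x < q ^ 3 + 1 ] (d x * d x)   ≡⟨ ∑-square-over-blocks d ⟩
      sum d * sum d + q * q * ∑[ x < q ^ 3 + 1 ] (d x * d x)    ≡⟨ cong₂ (λ u v → u * u + q * q * v) ∑d≡m*[q+1] ∑d²≡m*[m+q] ⟩
      m * (q + 1) * (m * (q + 1)) + q * q * (m * (m + q))       ∎
      where
      open ≡-Reasoning
      ∑n²-split : A₂ + m * (m + q) * (m + q) ≡ ∑[ L < b ] (n L * n L)
      ∑n²-split = begin
        A₂ + m * (m + q) * (m + q)           ≡⟨ +-comm A₂ _ ⟩
        m * (m + q) * (m + q) + A₂           ≡⟨ cong (_+ A₂) (trans (*-assoc m _ _) (sym (∑-over-C λ v → v * v))) ⟩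
        ∑[ L < b ] (c L * (n L * n L)) + A₂  ≡⟨ split (λ L → n L * n L) ⟨
        ∑[ L < b ] (n L * n L)               ∎

    ∑1-outside : (N + m) * (q + 1) ≡ (q ^ 3 + 1) * (q * q)
    ∑1-outside = trans (cong (_* (q + 1)) N+m≡b) block-count
      where
      N+m≡b : N + m ≡ b
      N+m≡b = begin
        N + m                     ≡⟨ +-comm N m ⟩
        m + N                     ≡⟨ ∑-distrib-+ c c∁ ⟨
        ∑[ L < b ] (c L + c∁ L)   ≡⟨ sum-cong-≗ (χ+χ∁≡1 C) ⟩
        ∑[ L < b ] 1              ≡⟨ sum-const b 1 ⟩
        b * 1                     ≡⟨ *-identityʳ b ⟩
        b                         ∎
        where open ≡-Reasoning

    defect-pointwise : ∀ L → c∁ L * (2 * n L * (q + 1)) ≤ c∁ L * (n L * n L + (q + 1) * (q + 1))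
    defect-pointwise L = *-monoʳ-≤ (c∁ L) (2*a*b≤a*a+b*b (n L) (q + 1))

    ∑defect-lhs : ∑[ L < b ] (c∁ L * (2 * n L * (q + 1))) ≡ 2 * (q + 1) * A₁
    ∑defect-lhs = sum-factorˡ (2 * (q + 1)) λ L → regroup (c∁ L) (n L) (q + 1)
      where
      regroup : ∀ a v Q → a * (2 * v * Q) ≡ 2 * Q * (a * v)
      regroup = solve-∀

    ∑defect-rhs : ∑[ L < b ] (c∁ L * (n L * n L + (q + 1) * (q + 1))) ≡ A₂ + N * ((q + 1) * (q + 1))
    ∑defect-rhs = trans (sum-cong-≗ λ L → *-distribˡ-+ (c∁ L) (n L * n L) _)
                        (trans (∑-distrib-+ (λ L → c∁ L * (n L * n L)) λ L → c∁ L * ((q + 1) * (q + 1)))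
                               (cong (A₂ +_) (sym (*-distribʳ-sum ((q + 1) * (q + 1)) c∁))))

    open CliqueSizeArithmetic q m A₁ A₂ N ∑n-outside ∑n²-outside ∑1-outside

    clique-size≤q² : 2 < q → m ≤ q * q
    clique-size≤q² 2<q = clique-size-≤ 2<q (subst₂ _≤_ ∑defect-lhs ∑defect-rhs (sum-mono-≤ defect-pointwise))

    outside-blocks-meet-q+1 : m ≡ q * q → ∀ L → c L ≡ 0 → n L ≡ q + 1
    outside-blocks-meet-q+1 m≡q² L cL≡0 = 2*a*b≡a*a+b*b⇒a≡b (n L) (q + 1) (begin
      2 * n L * (q + 1)                       ≡⟨ weight-one ⟨
      c∁ L * (2 * n L * (q + 1))              ≡⟨ ≤-pointwise-sum-≡⇒≡ defect-pointwise ∑equal L ⟩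
      c∁ L * (n L * n L + (q + 1) * (q + 1))  ≡⟨ weight-one ⟩
      n L * n L + (q + 1) * (q + 1)           ∎)
      where
      open ≡-Reasoning
      ∑equal : ∑[ L < b ] (c∁ L * (2 * n L * (q + 1))) ≡ ∑[ L < b ] (c∁ L * (n L * n L + (q + 1) * (q + 1)))
      ∑equal = trans ∑defect-lhs (trans (defect-zero m≡q²) (sym ∑defect-rhs))
      weight-one : ∀ {v} → c∁ L * v ≡ v
      weight-one {v} = trans (cong (λ w → (1 ∸ w) * v) cL≡0) (*-identityˡ v)

    c-joins : Fin (q ^ 3 + 1) → Fin (q ^ 3 + 1) → ℕ
    c-joins w u = ∑[ i < b ] (c i * (inc i w * inc i u))

    c-joins-self : ∀ w → c-joins w w ≡ d w
    c-joins-self w = sum-cong-≗ λ i → cong (c i *_) (χ-idem (block i) w)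

    c-joins≤1 : ∀ {w u} → w ≢ u → c-joins w u ≤ 1
    c-joins≤1 {w} {u} w≢u = ≤-trans (sum-mono-≤ λ i → m*n≤n (χ≤1 C i)) (≤-reflexive (joined-once w≢u))
      where
      m*n≤n : ∀ {a v} → a ≤ 1 → a * v ≤ v
      m*n≤n {a} {v} a≤1 = ≤-trans (*-monoˡ-≤ v a≤1) (≤-reflexive (*-identityˡ v))

    c-joins≤d : ∀ w u → c-joins w u ≤ d u
    c-joins≤d w u = sum-mono-≤ λ i → *-monoʳ-≤ (c i) (≤-trans (*-monoˡ-≤ (inc i u) (χ≤1 (block i) w)) (≤-reflexive (*-identityˡ _)))

    c-joins-positive : ∀ {i w u} → c i ≡ 1 → inc i w ≡ 1 → inc i u ≡ 1 → 0 < c-joins w u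
    c-joins-positive {i} {w} {u} ci iw iu =
      ≤-trans (≤-reflexive (sym (cong₂ _*_ ci (cong₂ _*_ iw iu)))) (term≤sum (λ i → c i * (inc i w * inc i u)) i)

    ∑c-joins≡d*[q+1] : ∀ u → sum (c-joins u) ≡ d u * (q + 1)
    ∑c-joins≡d*[q+1] u = begin
      ∑[ x < q ^ 3 + 1 ] ∑[ i < b ] (c i * (inc i u * inc i x))
        ≡⟨ ∑-comm (λ x i → c i * (inc i u * inc i x)) ⟩
      ∑[ i < b ] ∑[ x < q ^ 3 + 1 ] (c i * (inc i u * inc i x))
        ≡⟨ sum-cong-≗ (λ i → sum-factorˡ (c i * inc i u) λ x → sym (*-assoc (c i) (inc i u) (inc i x))) ⟩
      ∑[ i < b ] (c i * inc i u * sum (inc i))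
        ≡⟨ sum-cong-≗ (λ i → cong (c i * inc i u *_) (∑inc≡q+1 i)) ⟩
      ∑[ i < b ] (c i * inc i u * (q + 1))
        ≡⟨ *-distribʳ-sum (q + 1) (λ i → c i * inc i u) ⟨
      d u * (q + 1)
        ∎
      where open ≡-Reasoning

    ∑c-joins*d≡d*[m+q] : ∀ u → ∑[ x < q ^ 3 + 1 ] (c-joins u x * d x) ≡ d u * (m + q)
    ∑c-joins*d≡d*[m+q] u = begin
      ∑[ x < q ^ 3 + 1 ] (c-joins u x * d x)
        ≡⟨ sum-cong-≗ (λ x → *-distribʳ-sum (d x) λ i → c i * (inc i u * inc i x)) ⟩
      ∑[ x < q ^ 3 + 1 ] ∑[ i < b ] (c i * (inc i u * inc i x) * d x)
        ≡⟨ ∑-comm (λ x i → c i * (inc i u * inc i x) * d x) ⟩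
      ∑[ i < b ] ∑[ x < q ^ 3 + 1 ] (c i * (inc i u * inc i x) * d x)
        ≡⟨ sum-cong-≗ (λ i → sum-factorˡ (inc i u) λ x → regroup (c i) (inc i u) (inc i x) (d x)) ⟩
      ∑[ i < b ] (inc i u * ∑[ x < q ^ 3 + 1 ] (c i * (inc i x * d x)))
        ≡⟨ sum-cong-≗ (λ i → cong (inc i u *_) (*-distribˡ-sum (c i) λ x → inc i x * d x)) ⟨
      ∑[ i < b ] (inc i u * (c i * n i))
        ≡⟨ sum-cong-≗ (λ i → cong (inc i u *_) (c*f[n]≡c*f[m+q] (λ v → v) i)) ⟩
      ∑[ i < b ] (inc i u * (c i * (m + q)))
        ≡⟨ sum-cong-≗ (λ i → x*[y*z]≡y*x*z (inc i u) (c i) (m + q)) ⟩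
      ∑[ i < b ] (c i * inc i u * (m + q))
        ≡⟨ *-distribʳ-sum (m + q) (λ i → c i * inc i u) ⟨
      d u * (m + q)
        ∎
      where
      open ≡-Reasoning
      regroup : ∀ a v w z → a * (v * w) * z ≡ v * (a * (w * z))
      regroup = solve-∀
      x*[y*z]≡y*x*z : ∀ x y z → x * (y * z) ≡ y * x * z
      x*[y*z]≡y*x*z = solve-∀

    module NonPencil (2<q : 2 < q) (m≡q² : m ≡ q * q)
                     (escapes : ∀ x → ∃ λ E → c E ≡ 1 × inc E x ≡ 0) where

      ∑c-joins-along-block : ∀ {E w} → c E ≡ 1 → inc E w ≡ 0 → ∑[ u < q ^ 3 + 1 ] (inc E u * c-joins w u) ≡ d w
      ∑c-joins-along-block {E} {w} cE Ew = begin
        ∑[ u < q ^ 3 + 1 ] (inc E u * c-joins w u)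
          ≡⟨ ∑-*-∑-comm (inc E) (λ u i → c i * (inc i w * inc i u)) ⟩
        ∑[ i < b ] ∑[ u < q ^ 3 + 1 ] (inc E u * (c i * (inc i w * inc i u)))
          ≡⟨ sum-cong-≗ (λ i → sum-factorˡ (c i * inc i w) λ u → regroup (inc E u) (c i) (inc i w) (inc i u)) ⟩
        ∑[ i < b ] (c i * inc i w * ∑[ u < q ^ 3 + 1 ] (inc E u * inc i u))
          ≡⟨ sum-cong-≗ meets-E-once ⟩
        d w
          ∎
        where
        open ≡-Reasoning
        regroup : ∀ e a v u → e * (a * (v * u)) ≡ a * v * (e * u)
        regroup = solve-∀
        meets-E-once : ∀ i → c i * inc i w * ∑[ u < q ^ 3 + 1 ] (inc E u * inc i u) ≡ c i * inc i w
        meets-E-once i with χ*χ≡0⊎χ≡1×χ≡1 C i (block i) w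
        ... | inj₁ ≡0         = trans (cong (_* ∑[ u < q ^ 3 + 1 ] (inc E u * inc i u)) ≡0) (sym ≡0)
        ... | inj₂ (ci , iw) = trans (cong (c i * inc i w *_) (clique-meet-once cE ci E≢i)) (*-identityʳ _)
          where
          E≢i : E ≢ i
          E≢i refl = 0≢1+n (trans (sym Ew) iw)

      d≤q+1 : ∀ x → d x ≤ q + 1
      d≤q+1 x with escapes x
      ... | E , cE , Ex = begin
        d x                                         ≡⟨ ∑c-joins-along-block cE Ex ⟨
        ∑[ u < q ^ 3 + 1 ] (inc E u * c-joins x u)  ≤⟨ sum-mono-≤ c-joins≤1-on-E ⟩
        sum (inc E)                                 ≡⟨ ∑inc≡q+1 E ⟩
        q + 1                                       ∎
        where
        open ≤-Reasoning
        c-joins≤1-on-E : ∀ u → inc E u * c-joins x u ≤ inc E u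
        c-joins≤1-on-E u with χ-0∨1 (block E) u
        ... | inj₁ Eu≡0 = ≤-reflexive (trans (cong (_* _) Eu≡0) (sym Eu≡0))
        ... | inj₂ Eu≡1 = subst₂ _≤_ (trans (sym (*-identityˡ _)) (cong (_* _) (sym Eu≡1))) (sym Eu≡1)
                                     (c-joins≤1 λ { refl → 0≢1+n (trans (sym Ex) Eu≡1) })

      non-collinear-degrees : ∀ {w u} → w ≢ u → c-joins w u ≡ 0 → d w + d u ≤ q + 1
      non-collinear-degrees {w} {u} w≢u c-joins≡0 with joined w u w≢u
      ... | L , w∈L , u∈L = begin
        d w + d u                      ≡⟨ cong₂ _+_ (weight w∈L) (weight u∈L) ⟨
        inc L w * d w + inc L u * d u  ≤⟨ two-terms≤sum (λ x → inc L x * d x) w≢u ⟩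
        n L                            ≡⟨ outside-blocks-meet-q+1 m≡q² L cL≡0 ⟩
        q + 1                          ∎
        where
        open ≤-Reasoning
        weight : ∀ {x} → x ∈ block L → inc L x * d x ≡ d x
        weight {x} x∈L = trans (cong (_* d x) (∈⇒χ≡1 (block L) x x∈L)) (*-identityˡ (d x))
        cL≡0 : c L ≡ 0
        cL≡0 with χ-0∨1 C L
        ... | inj₁ cL≡0 = cL≡0
        ... | inj₂ cL≡1 = contradiction (sym c-joins≡0)
                            (<⇒≢ (c-joins-positive cL≡1 (∈⇒χ≡1 (block L) w w∈L) (∈⇒χ≡1 (block L) u u∈L)))

      ∑d≡q²*[q+1] : sum d ≡ q * q * (q + 1)
      ∑d≡q²*[q+1] = trans ∑d≡m*[q+1] (cong (_* (q + 1)) m≡q²)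

      ∑d²≡q²*[q²+q] : ∑[ x < q ^ 3 + 1 ] (d x * d x) ≡ q * q * (q * q + q)
      ∑d²≡q²*[q²+q] = trans ∑d²≡m*[m+q] (cong (λ v → v * (v + q)) m≡q²)

      module NoFullPoint (d≢q+1 : ∀ x → d x ≢ q + 1) where

        ∑d²≡∑q*d : ∑[ x < q ^ 3 + 1 ] (d x * d x) ≡ ∑[ x < q ^ 3 + 1 ] (q * d x)
        ∑d²≡∑q*d = begin
          ∑[ x < q ^ 3 + 1 ] (d x * d x)    ≡⟨ ∑d²≡q²*[q²+q] ⟩
          q * q * (q * q + q)               ≡⟨ regroup q ⟩
          q * (q * q * (q + 1))             ≡⟨ cong (q *_) ∑d≡q²*[q+1] ⟨
          q * sum d                         ≡⟨ *-distribˡ-sum q d ⟩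
          ∑[ x < q ^ 3 + 1 ] (q * d x)      ∎
          where
          open ≡-Reasoning
          regroup : ∀ q → q * q * (q * q + q) ≡ q * (q * q * (q + 1))
          regroup = solve-∀

        d²≤q*d : ∀ x → d x * d x ≤ q * d x
        d²≤q*d x = *-monoˡ-≤ (d x) (m<n+1⇒m≤n (≤∧≢⇒< (d≤q+1 x) (d≢q+1 x)))

        positive⇒d≡q : ∀ {x} → 0 < d x → d x ≡ q
        positive⇒d≡q {x} 0<dx = v*v≡q*v⇒v≡q 0<dx (≤-pointwise-sum-≡⇒≡ d²≤q*d ∑d²≡∑q*d x)

        w-positive : ∃ λ w → 0 < d w
        w-positive = 0<sum⇒∃0< d (subst (0 <_) (sym ∑d≡q²*[q+1]) (*-mono-≤ (*-mono-≤ q>0 q>0) (m≤n+m 1 q)))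

        w : Fin (q ^ 3 + 1)
        w = proj₁ w-positive

        E : Fin b
        E = proj₁ (escapes w)

        cE : c E ≡ 1
        cE = proj₁ (proj₂ (escapes w))

        Ew : inc E w ≡ 0
        Ew = proj₂ (proj₂ (escapes w))

        u-uncollinear : ∃ λ u → inc E u * c-joins w u < inc E u
        u-uncollinear = sum-<⇒∃< (λ u → inc E u * c-joins w u) (inc E) (begin-strict
          ∑[ u < q ^ 3 + 1 ] (inc E u * c-joins w u)
            ≡⟨ trans (∑c-joins-along-block cE Ew) (positive⇒d≡q (proj₂ w-positive)) ⟩
          q
            <⟨ m<m+n q (s≤s z≤n) ⟩
          q + 1
            ≡⟨ ∑inc≡q+1 E ⟨
          sum (inc E)
            ∎)
          where open ≤-Reasoning

        u : Fin (q ^ 3 + 1)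
        u = proj₁ u-uncollinear

        c-joins≡0 : c-joins w u ≡ 0
        c-joins≡0 = a*k<a⇒k≡0 (inc E u) (c-joins w u) (proj₂ u-uncollinear)

        Eu≡1 : inc E u ≡ 1
        Eu≡1 = 0<χ⇒χ≡1 (block E) u (≤-<-trans z≤n (proj₂ u-uncollinear))

        w≢u : w ≢ u
        w≢u w≡u = 0≢1+n (trans (sym Ew) (subst (λ x → inc E x ≡ 1) (sym w≡u) Eu≡1))

        0<du : 0 < d u
        0<du = ≤-trans (≤-reflexive (sym (cong₂ _*_ cE Eu≡1))) (term≤sum (λ i → c i * inc i u) E)

        impossible : ⊥
        impossible = <⇒≱ (<-trans (s≤s (s≤s z≤n)) 2<q) (+-cancelˡ-≤ q q 1 (begin
          q + q      ≡⟨ cong₂ _+_ (positive⇒d≡q (proj₂ w-positive)) (positive⇒d≡q 0<du) ⟨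
          d w + d u  ≤⟨ non-collinear-degrees w≢u c-joins≡0 ⟩
          q + 1      ∎))
          where open ≤-Reasoning

      Z : ℕ
      Z = ∑[ x < q ^ 3 + 1 ] sign (d x)

      module FullPoint {w} (dw≡q+1 : d w ≡ q + 1) where

        off-w-zero : ∀ {u} → u ≢ w → c-joins w u ≡ 0 → d u ≡ 0
        off-w-zero {u} u≢w c-joins≡0 = n≤0⇒n≡0 (+-cancelˡ-≤ (q + 1) (d u) 0 (begin
          q + 1 + d u  ≡⟨ cong (_+ d u) dw≡q+1 ⟨
          d w + d u    ≤⟨ non-collinear-degrees (u≢w ∘ sym) c-joins≡0 ⟩
          q + 1        ≡⟨ +-identityʳ (q + 1) ⟨
          q + 1 + 0    ∎))
          where open ≤-Reasoning

        support-bound : Z ≤ q * q + q + 1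
        support-bound = +-cancelʳ-≤ (q + 1) Z (q * q + q + 1) (begin
          Z + (q + 1)
            ≡⟨ cong (Z +_) (trans (c-joins-self w) dw≡q+1) ⟨
          Z + c-joins w w
            ≤⟨ sum-≤-except w sign-d≤c-joins ⟩
          sum (c-joins w) + sign (d w)
            ≡⟨ cong₂ _+_ (trans (∑c-joins≡d*[q+1] w) (cong (_* (q + 1)) dw≡q+1)) (trans (cong sign dw≡q+1) (sign-q+1 q)) ⟩
          (q + 1) * (q + 1) + 1
            ≡⟨ regroup q ⟩
          q * q + q + 1 + (q + 1)
            ∎)
          where
          open ≤-Reasoning
          regroup : ∀ q → (q + 1) * (q + 1) + 1 ≡ q * q + q + 1 + (q + 1)
          regroup = solve-∀
          sign-d≤c-joins : ∀ x → x ≢ w → sign (d x) ≤ c-joins w x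
          sign-d≤c-joins x x≢w = sign≤ (c-joins w x) (off-w-zero x≢w)

        no-middle-degree : ∀ {u} → 2 ≤ d u → d u ≤ q → ⊥
        no-middle-degree {u} 2≤du du≤q =
          middle-degree-impossible q j X Y Z 2<q 2≤du du≤q X-count X-bound Y-bound support-bound
          where
          j : ℕ
          j = d u
          far : Fin (q ^ 3 + 1) → ℕ
          far x = 1 ∸ c-joins u x
          X Y : ℕ
          X = ∑[ x < q ^ 3 + 1 ] (far x * d x)
          Y = ∑[ x < q ^ 3 + 1 ] (far x * sign (d x))

          far-u : far u ≡ 0
          far-u = m≤n⇒m∸n≡0 (≤-trans (≤-trans (s≤s z≤n) 2≤du) (≤-reflexive (sym (c-joins-self u))))

          sign-du : sign j ≡ 1
          sign-du = 0<v⇒sign≡1 (≤-trans (s≤s z≤n) 2≤du)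

          X-count : X + j * (q * q + q) + j ≡ q * q * (q + 1) + j * j
          X-count = begin
            X + j * (q * q + q) + j
              ≡⟨ cong (λ v → X + j * (v + q) + j) m≡q² ⟨
            X + j * (m + q) + j
              ≡⟨ cong (λ v → v + j) (cong (X +_) (∑c-joins*d≡d*[m+q] u)) ⟨
            X + ∑[ x < q ^ 3 + 1 ] (c-joins u x * d x) + j
              ≡⟨ cong (_+ j) (∑-distrib-+ (λ x → far x * d x) λ x → c-joins u x * d x) ⟨
            ∑[ x < q ^ 3 + 1 ] (far x * d x + c-joins u x * d x) + d u
              ≡⟨ sum-≡-except u split-d ⟩
            sum d + (far u * d u + c-joins u u * d u)
              ≡⟨ cong₂ _+_ ∑d≡q²*[q+1] (cong₂ (λ f k → f * j + k * j) far-u (c-joins-self u)) ⟩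
            q * q * (q + 1) + j * j
              ∎
            where
            open ≡-Reasoning
            split-d : ∀ x → x ≢ u → far x * d x + c-joins u x * d x ≡ d x
            split-d x x≢u = trans (sym (*-distribʳ-+ (d x) (far x) (c-joins u x)))
                                  (trans (cong (_* d x) (m∸n+n≡m (c-joins≤1 (x≢u ∘ sym)))) (*-identityˡ (d x)))

          X-bound : X + j * Y ≤ (q + 1) * Y
          X-bound = begin
            X + j * Y
              ≡⟨ cong (X +_) (*-distribˡ-sum j λ x → far x * sign (d x)) ⟩
            X + ∑[ x < q ^ 3 + 1 ] (j * (far x * sign (d x)))
              ≡⟨ ∑-distrib-+ (λ x → far x * d x) (λ x → j * (far x * sign (d x))) ⟨
            ∑[ x < q ^ 3 + 1 ] (far x * d x + j * (far x * sign (d x)))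
              ≤⟨ sum-mono-≤ (λ x → far-weight-bound (c-joins u x) (d x) j q (far-degree x)) ⟩
            ∑[ x < q ^ 3 + 1 ] ((q + 1) * (far x * sign (d x)))
              ≡⟨ *-distribˡ-sum (q + 1) (λ x → far x * sign (d x)) ⟨
            (q + 1) * Y
              ∎
            where
            open ≤-Reasoning
            far-degree : ∀ x → c-joins u x ≡ 0 → 0 < d x → d x + j ≤ q + 1
            far-degree x c-joins≡0 _ = subst (_≤ q + 1) (+-comm j (d x)) (non-collinear-degrees u≢x c-joins≡0)
              where
              u≢x : u ≢ x
              u≢x refl = <⇒≢ (≤-trans (s≤s z≤n) 2≤du) (sym (trans (sym (c-joins-self u)) c-joins≡0))

          Y-bound : Y + j * (q + 1) + 1 ≤ Z + j
          Y-bound = begin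
            Y + j * (q + 1) + 1
              ≡⟨ cong₂ _+_ (cong (Y +_) (∑c-joins≡d*[q+1] u)) sign-du ⟨
            Y + sum (c-joins u) + sign j
              ≡⟨ cong (_+ sign j) (∑-distrib-+ (λ x → far x * sign (d x)) (c-joins u)) ⟨
            ∑[ x < q ^ 3 + 1 ] (far x * sign (d x) + c-joins u x) + sign j
              ≤⟨ sum-≤-except u (λ x x≢u → far-sign-bound (c-joins u x) (d x) (c-joins≤1 (x≢u ∘ sym)) (c-joins≤d u x)) ⟩
            Z + (far u * sign j + c-joins u u)
              ≡⟨ cong (Z +_) (cong₂ (λ f k → f * sign j + k) far-u (c-joins-self u)) ⟩
            Z + j
              ∎
            where open ≤-Reasoning

        degree-values : ∀ x → d x ≡ 0 ⊎ d x ≡ 1 ⊎ d x ≡ q + 1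
        degree-values x = 0-1-or-q+1 (d≤q+1 x) no-middle-degree

        support-count : (q + 1) * Z + q * q * (q * q + q) ≡ (q + 2) * (q * q * (q + 1))
        support-count = begin
          (q + 1) * Z + q * q * (q * q + q)
            ≡⟨ cong₂ _+_ (sym (*-distribˡ-sum (q + 1) (sign ∘ d))) ∑d²≡q²*[q²+q] ⟨
          ∑[ x < q ^ 3 + 1 ] ((q + 1) * sign (d x)) + ∑[ x < q ^ 3 + 1 ] (d x * d x)
            ≡⟨ ∑-distrib-+ (λ x → (q + 1) * sign (d x)) (λ x → d x * d x) ⟨
          ∑[ x < q ^ 3 + 1 ] ((q + 1) * sign (d x) + d x * d x)
            ≡⟨ sum-cong-≗ (λ x → sign-on-three-values q (d x) (degree-values x)) ⟩
          ∑[ x < q ^ 3 + 1 ] ((q + 2) * d x)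
            ≡⟨ *-distribˡ-sum (q + 2) d ⟨
          (q + 2) * sum d
            ≡⟨ cong ((q + 2) *_) ∑d≡q²*[q+1] ⟩
          (q + 2) * (q * q * (q + 1))
            ∎
          where open ≡-Reasoning

        impossible : ⊥
        impossible = support-size-impossible q Z 2<q support-count support-bound

      impossible : ⊥
      impossible with any? (λ x → d x ≟ q + 1)
      ... | yes (w , dw≡q+1) = FullPoint.impossible dw≡q+1
      ... | no  ∄w           = NoFullPoint.impossible (λ x dx≡q+1 → ∄w (x , dx≡q+1))

    maximal-clique-is-pencil : 2 < q → m ≡ q * q → ∃ λ x → ∀ i → c i ≡ inc i x
    maximal-clique-is-pencil 2<q m≡q² with any? (λ x → all? λ i → (c i ≟ 1) →-dec (inc i x ≟ 1))
    ... | yes (x , C⊆Bx) = x , ≤-pointwise-sum-≡⇒≡ c≤inc (trans m≡q² (sym (replication x)))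
      where
      c≤inc : ∀ i → c i ≤ inc i x
      c≤inc i with χ-0∨1 C i
      ... | inj₁ ci≡0 = ≤-trans (≤-reflexive ci≡0) z≤n
      ... | inj₂ ci≡1 = ≤-reflexive (trans ci≡1 (sym (C⊆Bx i ci≡1)))
    ... | no ∄x = ⊥-elim (NonPencil.impossible 2<q m≡q² escapes)
      where
      escapes : ∀ x → ∃ λ E → c E ≡ 1 × inc E x ≡ 0
      escapes x with ¬∀⟶∃¬ b _ (λ i → (c i ≟ 1) →-dec (inc i x ≟ 1)) (λ C⊆Bx → ∄x (x , C⊆Bx))
      ... | E , C⊈Bx with χ-0∨1 C E | χ-0∨1 (block E) x
      ...   | inj₁ cE≡0 | _         = ⊥-elim (C⊈Bx λ cE≡1 → ⊥-elim (0≢1+n (trans (sym cE≡0) cE≡1)))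
      ...   | inj₂ _    | inj₂ Ex≡1 = ⊥-elim (C⊈Bx λ _ → Ex≡1)
      ...   | inj₂ cE≡1 | inj₁ Ex≡0 = E , cE≡1 , Ex≡0

theorem2p1 : (q : ℕ) → 2 < q → (U : Unital q) → (C : Subset (Unital.b U)) →
    IsClique U C →
    (∣ C ∣ ≤ q ^ 2) × (∣ C ∣ ≡ q ^ 2 ⇔ ∃ λ x → IsPencil U C x)
theorem2p1 q 2<q U C clique =
  subst₂ _≤_ (sym ∣C∣≡m) (sym q^2≡q*q) (clique-size≤q² 2<q) , mk⇔ maximal⇒pencil pencil⇒maximal
  where
  open Unital U using (b; block)
  open UnitalCounting U (≤-trans (s≤s z≤n) 2<q)
  open Clique C clique
  ∣C∣≡m : ∣ C ∣ ≡ m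
  ∣C∣≡m = ∣p∣≡sumχ C
  q^2≡q*q : q ^ 2 ≡ q * q
  q^2≡q*q = cong (q *_) (*-identityʳ q)
  maximal⇒pencil : ∣ C ∣ ≡ q ^ 2 → ∃ λ x → IsPencil U C x
  maximal⇒pencil ∣C∣≡q² =
    let x , c≗inc = maximal-clique-is-pencil 2<q (trans (sym ∣C∣≡m) (trans ∣C∣≡q² q^2≡q*q))
    in x , λ i → Equivalence.to (χ≡χ⇔∈⇔∈ C i (block i) x) (c≗inc i)
  pencil⇒maximal : (∃ λ x → IsPencil U C x) → ∣ C ∣ ≡ q ^ 2
  pencil⇒maximal (x , pencil) = begin
    ∣ C ∣        ≡⟨ ∣C∣≡m ⟩
    m            ≡⟨ sum-cong-≗ (λ i → Equivalence.from (χ≡χ⇔∈⇔∈ C i (block i) x) (pencil i)) ⟩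
    ∑[ i < b ] inc i x ≡⟨ replication x ⟩
    q * q        ≡⟨ q^2≡q*q ⟨
    q ^ 2        ∎
    where open ≡-Reasoning
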